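{- If $n\ge 3$ is odd, then $\mathrm{sg_e}(K_{n,n}) \geq n+2$ and $\mathrm{sg_e}(K_{n,n-1}) \geq n+1$.
   Context: All graphs are finite and simple; $K_{n,m}$ is the complete bipartite graph with parts of sizes $n$ and $m$. For a graph $G$, a set $S\subseteq V(G)$ is a strong edge geodetic set if to each (unordered) pair of vertices $u,v\in S$ one can assign one shortest $u,v$-path (or no path) such that every edge of $G$ lies on at least one of the assigned paths. The strong edge geodetic number $\mathrm{sg_e}(G)$ is the minimum cardinality of a strong edge geodetic set of $G$. -}

module Defs where

open import Data.Nat using (ℕ; zero; suc; _+_; _*_; _∸_; _≤_; _<_)
open import Data.Nat.Properties using (<⇒≱; <-≤-trans)
open import Data.Fin using (Fin; toℕ)
open import Data.Fin.Subset using (Subset; _∈_)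
open import Data.List using (List; []; _∷_; length)
open import Data.Maybe using (Maybe; just)
open import Data.Product using (Σ; ∃; _×_; _,_)
open import Data.Sum using (_⊎_; inj₁; inj₂)
open import Data.Empty using (⊥)
open import Relation.Nullary using (¬_)
open import Relation.Binary.PropositionalEquality using (_≡_)

record Graph : Set₁ where
  field
    V      : ℕ
    Adj    : Fin V → Fin V → Set
    sym    : ∀ {x y} → Adj x y → Adj y x
    irrefl : ∀ {x} → ¬ Adj x x

open Graph public

-- The complete bipartite graph K_{n,m}: vertices Fin (n + m),
-- parts {i | toℕ i < n} (size n) and {i | n ≤ toℕ i} (size m).
KAdj : (n m : ℕ) → Fin (n + m) → Fin (n + m) → Set
KAdj n m i j = (toℕ i < n × n ≤ toℕ j) ⊎ (n ≤ toℕ i × toℕ j < n)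

K : ℕ → ℕ → Graph
K n m = record
  { V = n + m
  ; Adj = KAdj n m
  ; sym = λ { (inj₁ (a , b)) → inj₂ (b , a) ; (inj₂ (a , b)) → inj₁ (b , a) }
  ; irrefl = λ { (inj₁ (a , b)) → <⇒≱ a b ; (inj₂ (a , b)) → <⇒≱ b a }
  }

data IsWalk (G : Graph) : Fin (V G) → Fin (V G) → List (Fin (V G)) → Set where
  single : ∀ u → IsWalk G u u (u ∷ [])
  step   : ∀ {u w v xs} → Adj G u w → IsWalk G w v xs → IsWalk G u v (u ∷ xs)

-- A shortest u,v-path: a u,v-walk with no shorter u,v-walk
-- (such a walk is automatically a path). Lengths compared via the
-- number of vertices in the list (= number of edges + 1).
IsShortestPath : (G : Graph) → Fin (V G) → Fin (V G) → List (Fin (V G)) → Set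
IsShortestPath G u v p =
  IsWalk G u v p × (∀ q → IsWalk G u v q → length p ≤ length q)

data EdgeOn {A : Set} (x y : A) : List A → Set where
  here  : ∀ {xs} → EdgeOn x y (x ∷ y ∷ xs)
  here' : ∀ {xs} → EdgeOn x y (y ∷ x ∷ xs)
  there : ∀ {z xs} → EdgeOn x y xs → EdgeOn x y (z ∷ xs)

-- S is a strong edge geodetic set of G: to each unordered pair {u,v} ⊆ S
-- (represented as u < v) one assigns a shortest u,v-path or nothing,
-- so that every edge of G lies on some assigned path.
record StrongEdgeGeodetic (G : Graph) (S : Subset (V G)) : Set where
  field
    assign   : (u v : Fin (V G)) → u ∈ S → v ∈ S → toℕ u < toℕ v
               → Maybe (List (Fin (V G)))
    shortest : ∀ u v (hu : u ∈ S) (hv : v ∈ S) (lt : toℕ u < toℕ v) p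
               → assign u v hu hv lt ≡ just p → IsShortestPath G u v p
    cover    : ∀ x y → Adj G x y →
               Σ (Fin (V G)) λ u → Σ (Fin (V G)) λ v →
               Σ (u ∈ S) λ hu → Σ (v ∈ S) λ hv → Σ (toℕ u < toℕ v) λ lt →
               Σ (List (Fin (V G))) λ p →
               (assign u v hu hv lt ≡ just p) × EdgeOn x y p

Odd : ℕ → Set
Odd n = Σ ℕ λ k → n ≡ suc (2 * k)

-- In K_{n,m} every shortest path has at most two edges, so every edge meets S and one part P
-- of the bipartition lies inside S. Let Out be the vertices of the other part Q outside S. An edge
-- x w with x ∈ P, w ∈ Out can only be covered by the path x w o assigned to a pair {x, o} ⊆ P; as
-- each pair gets a single path, w ↦ o is injective for fixed x, so |Out| ≤ |P| - 1 and
-- |S| ≥ |P| + |Q| - |Out| ≥ |Q| + 1. If |Out| = |P| - 1, these maps are bijections, and for a fixed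
-- w ∈ Out the map x ↦ o is a fixed-point-free involution of P, so |P| is even. Hence |S| ≥ |Q| + 2
-- when |P| is odd, which gives both bounds.

module Submission where

open import Defs hiding (sym)

open import Data.Nat using (ℕ; zero; suc; _+_; _*_; _∸_; _≤_; _<_; z≤n; s≤s; s≤s⁻¹)
open import Data.Nat.Properties
  using ( ≤-refl; ≤-trans; ≤-reflexive; ≤-antisym; n≤1+n; m≤m+n; <-asym; <⇒≱; ≮⇒≥; ≤∧≢⇒<
        ; <-irrelevant; +-assoc; +-comm; +-suc; +-identityʳ; +-monoʳ-≤; ∸-monoˡ-≤; m∸n+n≡m
        ; even≢odd; module ≤-Reasoning)
open import Data.Fin using (Fin; zero; suc; toℕ; fromℕ<; _<?_; _↑ˡ_; _↑ʳ_; splitAt)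
open import Data.Fin.Properties
  using ( _≟_; toℕ-injective; <⇒≢; injective⇒≤; toℕ<n; toℕ-↑ˡ; toℕ-↑ʳ; ↑ˡ-injective; ↑ʳ-injective
        ; splitAt⁻¹-↑ˡ; splitAt⁻¹-↑ʳ)
open import Data.Fin.Subset using (Subset; ∣_∣; _-_) renaming (_∈_ to _∈ₛ_)
open import Data.Fin.Subset.Properties
  using (x∈p⇒∣p-x∣<∣p∣; x∈p∧x≢y⇒x∈p-y) renaming (_∈?_ to _∈ₛ?_)
open import Data.List using (List; []; _∷_; length; lookup; filter; tabulate)
open import Data.List.Properties using (filter-notAll; length-++; length-tabulate)
open import Data.List.Membership.Propositional using (_∈_; _∉_; find; lose)
open import Data.List.Membership.Propositional.Properties
  using (∈-lookup; ∈-filter⁺; ∈-filter⁻; ∈-tabulate⁺; ∈-tabulate⁻)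
import Data.List.Membership.DecPropositional as DecMembership
open import Data.List.Relation.Unary.All as All using (All; []; _∷_; all?)
open import Data.List.Relation.Unary.All.Properties using (¬Any⇒All¬; ¬All⇒Any¬; all-filter; ++⁺)
open import Data.List.Relation.Unary.Any as Any using (here; there; any?)
open import Data.List.Relation.Unary.Any.Properties using (lookup-index)
open import Data.List.Relation.Unary.Unique.Propositional using (Unique; []; _∷_)
import Data.List.Relation.Unary.Unique.Propositional.Properties as Unique
open import Data.Maybe using (just)
open import Data.Maybe.Properties using (just-injective)
open import Data.Product using (Σ; ∃; _×_; _,_; proj₁; proj₂)
open import Data.Sum as Sum using (_⊎_; inj₁; inj₂)
open import Data.Vec.Properties.WithK using ([]=-irrelevant)
open import Function using (_∘_; id)
open import Relation.Nullary using (¬_; yes; no; contradiction)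
open import Relation.Unary using (Decidable)
open import Relation.Unary.Properties using (∁?)
open import Relation.Binary.Definitions using (DecidableEquality)
open import Relation.Binary.PropositionalEquality
  using (_≡_; _≢_; refl; sym; trans; cong; subst; subst₂; module ≡-Reasoning)

private
  variable
    A B : Set

-- Counting with duplicate-free lists

∈-of-length : ∀ {k} {xs : List A} → suc k ≤ length xs → ∃ (_∈ xs)
∈-of-length k<xs = _ , ∈-lookup (fromℕ< (≤-trans (s≤s z≤n) k<xs))

InjectiveOn : (A → B) → List A → Set
InjectiveOn f xs = ∀ {a b} → a ∈ xs → b ∈ xs → f a ≡ f b → a ≡ b

lookup-injective : ∀ {xs : List A} → Unique xs → ∀ i j → lookup xs i ≡ lookup xs j → i ≡ j
lookup-injective (_   ∷ _) zero    zero    _  = refl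
lookup-injective (x∉ ∷ _) zero    (suc j) eq = contradiction eq (All.lookup x∉ (∈-lookup j))
lookup-injective (x∉ ∷ _) (suc i) zero    eq = contradiction (sym eq) (All.lookup x∉ (∈-lookup i))
lookup-injective (_   ∷ u) (suc i) (suc j) eq = cong suc (lookup-injective u i j eq)

injectiveOn⇒length≤ : (f : A → B) {xs : List A} {ys : List B} → Unique xs → InjectiveOn f xs →
                      (∀ {a} → a ∈ xs → f a ∈ ys) → length xs ≤ length ys
injectiveOn⇒length≤ f {xs} {ys} xs-unique f-injective f-into = injective⇒≤ position-injective
  where
  position : Fin (length xs) → Fin (length ys)
  position i = Any.index (f-into (∈-lookup i))

  position-injective : ∀ {i j} → position i ≡ position j → i ≡ j
  position-injective {i} {j} eq = lookup-injective xs-unique i j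
    (f-injective (∈-lookup i) (∈-lookup j) (begin
      f (lookup xs i)        ≡⟨ lookup-index (f-into (∈-lookup i)) ⟩
      lookup ys (position i) ≡⟨ cong (lookup ys) eq ⟩
      lookup ys (position j) ≡⟨ lookup-index (f-into (∈-lookup j)) ⟨
      f (lookup xs j)        ∎))
    where open ≡-Reasoning

-- If z were missed, f would inject xs into ys with z filtered out, which is shorter than ys.
length≤⇒surjectiveOn : DecidableEquality B → (f : A → B) {xs : List A} {ys : List B} →
                       Unique xs → InjectiveOn f xs → (∀ {a} → a ∈ xs → f a ∈ ys) →
                       length ys ≤ length xs → ∀ {z} → z ∈ ys → ∃ λ a → a ∈ xs × f a ≡ z
length≤⇒surjectiveOn _≟_ f {xs} {ys} xs-unique f-injective f-into ys≤xs {z} z∈ys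
  with any? (λ a → f a ≟ z) xs
... | yes hit  = find hit
... | no  miss = contradiction ys≤xs (<⇒≱ (begin-strict
      length xs              ≤⟨ injectiveOn⇒length≤ f xs-unique f-injective into-rest ⟩
      length (filter ≢z? ys) <⟨ filter-notAll ≢z? ys (Any.map (λ z≡b b≢z → b≢z (sym z≡b)) z∈ys) ⟩
      length ys              ∎))
  where
  open ≤-Reasoning
  ≢z? : Decidable (_≢ z)
  ≢z? = ∁? (_≟ z)
  into-rest : ∀ {a} → a ∈ xs → f a ∈ filter ≢z? ys
  into-rest a∈xs = ∈-filter⁺ ≢z? (f-into a∈xs) (miss ∘ lose a∈xs)

length-filter+length-filter-∁ : ∀ {P : A → Set} (P? : Decidable P) xs →
  length (filter P? xs) + length (filter (∁? P?) xs) ≡ length xs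
length-filter+length-filter-∁ P? []       = refl
length-filter+length-filter-∁ P? (x ∷ xs) with P? x
... | yes _ = cong suc (length-filter+length-filter-∁ P? xs)
... | no  _ = trans (+-suc _ _) (cong suc (length-filter+length-filter-∁ P? xs))

Even : ℕ → Set
Even n = ∃ λ k → n ≡ 2 * k

Even⇒¬Odd : ∀ {n} → Even n → ¬ Odd n
Even⇒¬Odd (k , n≡2k) (j , n≡1+2j) = even≢odd k j (trans (sym n≡2k) n≡1+2j)

-- τ swaps the elements x with x < τ x and those with τ x < x, so there are equally many of each.
involution⇒even-length : ∀ {N} (τ : Fin N → Fin N) {xs : List (Fin N)} → Unique xs →
  (∀ {x} → x ∈ xs → τ x ∈ xs) → (∀ {x} → x ∈ xs → τ (τ x) ≡ x) → (∀ {x} → x ∈ xs → τ x ≢ x) →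
  Even (length xs)
involution⇒even-length {N} τ {xs} xs-unique τ-into τ-involutive τ-fixfree =
  length ascending , (begin
    length xs                                     ≡⟨ length-filter+length-filter-∁ ascends? xs ⟨
    length ascending + length descending          ≡⟨ cong (length ascending +_) equal ⟩
    length ascending + length ascending           ≡⟨ cong (length ascending +_) (+-identityʳ _) ⟨
    2 * length ascending                          ∎)
  where
  open ≡-Reasoning
  ascends? : Decidable (λ x → toℕ x < toℕ (τ x))
  ascends? x = x <? τ x

  ascending descending : List (Fin N)
  ascending  = filter ascends? xs
  descending = filter (∁? ascends?) xs

  τ-injective : ∀ {ys} → (∀ {y} → y ∈ ys → y ∈ xs) → InjectiveOn τ ys
  τ-injective ys⊆xs {a} {b} a∈ b∈ eq =
    trans (sym (τ-involutive (ys⊆xs a∈))) (trans (cong τ eq) (τ-involutive (ys⊆xs b∈)))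

  up→down : ∀ {x} → x ∈ ascending → τ x ∈ descending
  up→down x∈ with x∈xs , x<τx ← ∈-filter⁻ ascends? x∈ =
    ∈-filter⁺ (∁? ascends?) (τ-into x∈xs) λ τx<ττx →
      <-asym x<τx (subst (λ y → toℕ (τ _) < toℕ y) (τ-involutive x∈xs) τx<ττx)

  down→up : ∀ {x} → x ∈ descending → τ x ∈ ascending
  down→up x∈ with x∈xs , x≮τx ← ∈-filter⁻ (∁? ascends?) x∈ =
    ∈-filter⁺ ascends? (τ-into x∈xs)
      (subst (λ y → toℕ (τ _) < toℕ y) (sym (τ-involutive x∈xs))
        (≤∧≢⇒< (≮⇒≥ x≮τx) (τ-fixfree x∈xs ∘ toℕ-injective)))

  equal : length descending ≡ length ascending
  equal = ≤-antisym
    (injectiveOn⇒length≤ τ (Unique.filter⁺ (∁? ascends?) xs-unique)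
      (τ-injective (proj₁ ∘ ∈-filter⁻ (∁? ascends?))) down→up)
    (injectiveOn⇒length≤ τ (Unique.filter⁺ ascends? xs-unique)
      (τ-injective (proj₁ ∘ ∈-filter⁻ ascends?)) up→down)

unique⊆⇒length≤∣_∣ : ∀ {N} (S : Subset N) {xs} → Unique xs → All (_∈ₛ S) xs → length xs ≤ ∣ S ∣
unique⊆⇒length≤∣ S ∣ []             []             = z≤n
unique⊆⇒length≤∣ S ∣ {x ∷ xs} (x∉xs ∷ unique) (x∈S ∷ xs⊆S) = begin-strict
  length xs ≤⟨ unique⊆⇒length≤∣ S - x ∣ unique xs⊆S-x ⟩
  ∣ S - x ∣ <⟨ x∈p⇒∣p-x∣<∣p∣ x∈S ⟩
  ∣ S ∣     ∎
  where
  open ≤-Reasoning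
  xs⊆S-x : All (_∈ₛ S - x) xs
  xs⊆S-x = All.zipWith (λ (y∈S , x≢y) → x∈p∧x≢y⇒x∈p-y y∈S (x≢y ∘ sym)) (xs⊆S , x∉xs)

module Routing {N} (Routed : Fin N → Fin N → Fin N → Set)
  (Routed-sym        : ∀ {x w o} → Routed x w o → Routed o w x)
  (Routed-functional : ∀ {x w w′ o} → Routed x w o → Routed x w′ o → w ≡ w′)
  (Routed-irrefl     : ∀ {x w o} → Routed x w o → x ≢ o)
  {P Out : List (Fin N)} (P-unique : Unique P) (Out-unique : Unique Out)
  (P-disjoint-Out : ∀ {x} → x ∈ P → x ∉ Out)
  (partner-exists : ∀ {x w} → x ∈ P → w ∈ Out → ∃ λ o → o ∈ P × Routed x w o)
  where

  open DecMembership (_≟_ {N}) using (_∈?_)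

  -- The value x outside P × Out is a junk default; it makes partner x inject x ∷ Out into P.
  partner : Fin N → Fin N → Fin N
  partner x w with x ∈? P | w ∈? Out
  ... | yes x∈P | yes w∈Out = proj₁ (partner-exists x∈P w∈Out)
  ... | _       | _         = x

  partner-spec : ∀ {x w} → x ∈ P → w ∈ Out → partner x w ∈ P × Routed x w (partner x w)
  partner-spec {x} {w} x∈P w∈Out with x ∈? P | w ∈? Out
  ... | yes x∈P′ | yes w∈Out′ = proj₂ (partner-exists x∈P′ w∈Out′)
  ... | no x∉P   | _          = contradiction x∈P x∉P
  ... | yes _    | no w∉Out   = contradiction w∈Out w∉Out

  partner-default : ∀ {x w} → w ∉ Out → partner x w ≡ x
  partner-default {x} {w} w∉Out with x ∈? P | w ∈? Out
  ... | yes _ | yes w∈Out = contradiction w∈Out w∉Out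
  ... | yes _ | no  _     = refl
  ... | no  _ | _         = refl

  partner-injective : ∀ {x} → x ∈ P → InjectiveOn (partner x) (x ∷ Out)
  partner-injective x∈P (here refl) (here refl)   _  = refl
  partner-injective x∈P (here refl) (there b∈Out) eq =
    contradiction (trans (sym (partner-default (P-disjoint-Out x∈P))) eq)
                  (Routed-irrefl (proj₂ (partner-spec x∈P b∈Out)))
  partner-injective x∈P (there a∈Out) (here refl) eq =
    contradiction (trans (sym (partner-default (P-disjoint-Out x∈P))) (sym eq))
                  (Routed-irrefl (proj₂ (partner-spec x∈P a∈Out)))
  partner-injective x∈P (there a∈Out) (there b∈Out) eq =
    Routed-functional (proj₂ (partner-spec x∈P a∈Out))
      (subst (Routed _ _) (sym eq) (proj₂ (partner-spec x∈P b∈Out)))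

  partner-into : ∀ {x} → x ∈ P → ∀ {w} → w ∈ x ∷ Out → partner x w ∈ P
  partner-into x∈P (here refl)   = subst (_∈ P) (sym (partner-default (P-disjoint-Out x∈P))) x∈P
  partner-into x∈P (there w∈Out) = proj₁ (partner-spec x∈P w∈Out)

  x∷Out-unique : ∀ {x} → x ∈ P → Unique (x ∷ Out)
  x∷Out-unique x∈P = ¬Any⇒All¬ Out (P-disjoint-Out x∈P) ∷ Out-unique

  length-Out<length-P : ∀ {x} → x ∈ P → length Out < length P
  length-Out<length-P x∈P =
    injectiveOn⇒length≤ (partner _) (x∷Out-unique x∈P) (partner-injective x∈P) (partner-into x∈P)

  -- When Out is as large as allowed, partner y is onto P, so x is reached from y by some
  -- outside vertex; the assigned path between x and y is unique, so that vertex is w.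
  partner-involutive : ∀ {w} → w ∈ Out → length P ≤ suc (length Out) →
                       ∀ {x} → x ∈ P → partner (partner x w) w ≡ x
  partner-involutive {w} w∈Out P≤ {x} x∈P
    with y∈P , x→y ← partner-spec x∈P w∈Out
    with length≤⇒surjectiveOn _≟_ (partner _) (x∷Out-unique y∈P) (partner-injective y∈P)
                              (partner-into y∈P) P≤ x∈P
  ... | _ , here refl , y≡x = contradiction
        (trans (sym (partner-default (P-disjoint-Out y∈P))) y≡x) (Routed-irrefl x→y ∘ sym)
  ... | a , there a∈Out , ya≡x =
        trans (cong (partner _) (Routed-functional (Routed-sym x→y) y→x)) ya≡x
    where
    y→x : Routed (partner _ _) a _
    y→x = subst (Routed _ _) ya≡x (proj₂ (partner-spec y∈P a∈Out))

  length-P-even : ∀ {w} → w ∈ Out → length P ≤ suc (length Out) → Even (length P)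
  length-P-even {w} w∈Out P≤ = involution⇒even-length (λ x → partner x w) P-unique
    (λ x∈P → proj₁ (partner-spec x∈P w∈Out))
    (partner-involutive w∈Out P≤)
    (λ x∈P → Routed-irrefl (proj₂ (partner-spec x∈P w∈Out)) ∘ sym)

-- Strong edge geodetic sets in graphs of diameter two

count-bound : ∀ {a b q k p s} → a + b ≡ q → k + b ≤ p → p + a ≤ s → q + k ≤ s
count-bound {a} {b} {q} {k} {p} {s} a+b≡q k+b≤p p+a≤s = begin
  q + k       ≡⟨ cong (_+ k) a+b≡q ⟨
  a + b + k   ≡⟨ +-assoc a b k ⟩
  a + (b + k) ≡⟨ cong (a +_) (+-comm b k) ⟩
  a + (k + b) ≤⟨ +-monoʳ-≤ a k+b≤p ⟩
  a + p       ≡⟨ +-comm a p ⟩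
  p + a       ≤⟨ p+a≤s ⟩
  s           ∎
  where open ≤-Reasoning

SideBound : ∀ {N} → Subset N → ℕ → ℕ → Set
SideBound S p q = q + 1 ≤ ∣ S ∣ × (Odd p → q + 2 ≤ ∣ S ∣)

Diameter≤2 : Graph → Set
Diameter≤2 G = ∀ u v → ∃ λ q → IsWalk G u v q × length q ≤ 3

module _ {G : Graph} (diameter≤2 : Diameter≤2 G) where

  shortestPath-shape : ∀ {u v p} → u ≢ v → IsShortestPath G u v p →
                       p ≡ u ∷ v ∷ [] ⊎ ∃ λ c → p ≡ u ∷ c ∷ v ∷ []
  shortestPath-shape {u} {v} u≢v (walk , minimal)
    with q , q-walk , q≤3 ← diameter≤2 u v
    with walk | ≤-trans (minimal q q-walk) q≤3
  ... | single _                             | _ = contradiction refl u≢v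
  ... | step _ (single _)                    | _ = inj₁ refl
  ... | step _ (step _ (single _))           | _ = inj₂ (_ , refl)
  ... | step _ (step _ (step _ (single _)))  | s≤s (s≤s (s≤s ()))
  ... | step _ (step _ (step _ (step _ _)))  | s≤s (s≤s (s≤s ()))

EdgeOn-end : ∀ {A : Set} {x y a b : A} → EdgeOn x y (a ∷ b ∷ []) → y ≡ a ⊎ y ≡ b
EdgeOn-end here               = inj₂ refl
EdgeOn-end here'              = inj₁ refl
EdgeOn-end (there (there ()))

EdgeOn-middle : ∀ {A : Set} {x y a c b : A} → EdgeOn x y (a ∷ c ∷ b ∷ []) → y ≢ a → y ≢ b →
                y ≡ c × (x ≡ a ⊎ x ≡ b)
EdgeOn-middle here                       _   _   = refl , inj₁ refl
EdgeOn-middle here'                      y≢a _   = contradiction refl y≢a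
EdgeOn-middle (there here)               _   y≢b = contradiction refl y≢b
EdgeOn-middle (there here')              _   _   = refl , inj₂ refl
EdgeOn-middle (there (there (there ())))

module DiameterTwo {G : Graph} (diameter≤2 : Diameter≤2 G)
                   {S : Subset (V G)} (sg : StrongEdgeGeodetic G S) where

  open StrongEdgeGeodetic sg

  Assigned : Fin (V G) → Fin (V G) → List (Fin (V G)) → Set
  Assigned u v p = Σ (u ∈ₛ S) λ u∈S → Σ (v ∈ₛ S) λ v∈S → Σ (toℕ u < toℕ v) λ u<v →
                   assign u v u∈S v∈S u<v ≡ just p

  Assigned-functional : ∀ {u v p q} → Assigned u v p → Assigned u v q → p ≡ q
  Assigned-functional (u∈S , v∈S , u<v , eq) (u∈S′ , v∈S′ , u<v′ , eq′)
    rewrite []=-irrelevant u∈S u∈S′ | []=-irrelevant v∈S v∈S′ | <-irrelevant u<v u<v′ =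
    just-injective (trans (sym eq) eq′)

  Assigned⇒IsWalk : ∀ {u v p} → Assigned u v p → IsWalk G u v p
  Assigned⇒IsWalk (u∈S , v∈S , u<v , eq) = proj₁ (shortest _ _ u∈S v∈S u<v _ eq)

  Routed : Fin (V G) → Fin (V G) → Fin (V G) → Set
  Routed x w o = Assigned x o (x ∷ w ∷ o ∷ []) ⊎ Assigned o x (o ∷ w ∷ x ∷ [])

  Routed-sym : ∀ {x w o} → Routed x w o → Routed o w x
  Routed-sym = Sum.swap

  Routed-functional : ∀ {x w w′ o} → Routed x w o → Routed x w′ o → w ≡ w′
  Routed-functional (inj₁ a) (inj₁ a′) with Assigned-functional a a′
  ... | refl = refl
  Routed-functional (inj₂ a) (inj₂ a′) with Assigned-functional a a′
  ... | refl = refl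
  Routed-functional (inj₁ (_ , _ , x<o , _)) (inj₂ (_ , _ , o<x , _)) =
    contradiction o<x (<-asym x<o)
  Routed-functional (inj₂ (_ , _ , o<x , _)) (inj₁ (_ , _ , x<o , _)) =
    contradiction o<x (<-asym x<o)

  Routed-irrefl : ∀ {x w o} → Routed x w o → x ≢ o
  Routed-irrefl (inj₁ (_ , _ , x<o , _)) = <⇒≢ x<o
  Routed-irrefl (inj₂ (_ , _ , o<x , _)) = <⇒≢ o<x ∘ sym

  Routed⇒∈ₛ : ∀ {x w o} → Routed x w o → x ∈ₛ S
  Routed⇒∈ₛ (inj₁ (x∈S , _ , _ , _)) = x∈S
  Routed⇒∈ₛ (inj₂ (_ , x∈S , _ , _)) = x∈S

  Routed⇒Adj : ∀ {x w o} → Routed x w o → Adj G w o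
  Routed⇒Adj (inj₁ a) with Assigned⇒IsWalk a
  ... | step _ (step w~o (single _)) = w~o
  Routed⇒Adj (inj₂ a) with Assigned⇒IsWalk a
  ... | step o~w (step _ (single _)) = Graph.sym G o~w

  ∉∧∈⇒≢ : ∀ {a b} → ¬ a ∈ₛ S → b ∈ₛ S → a ≢ b
  ∉∧∈⇒≢ a∉S b∈S refl = a∉S b∈S

  -- Both ends of an assigned path lie in S, so an edge x w with w ∉ S lies only on paths x w o.
  through-outside : ∀ {x w} → ¬ w ∈ₛ S → Adj G x w → ∃ λ o → Routed x w o
  through-outside {x} {w} w∉S x~w with cover x w x~w
  ... | u , v , u∈S , v∈S , u<v , p , eq , on
    with shortestPath-shape diameter≤2 (<⇒≢ u<v) (shortest u v u∈S v∈S u<v p eq)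
  ... | inj₁ refl = contradiction (EdgeOn-end on) Sum.[ ∉∧∈⇒≢ w∉S u∈S , ∉∧∈⇒≢ w∉S v∈S ]
  ... | inj₂ (c , refl) with EdgeOn-middle on (∉∧∈⇒≢ w∉S u∈S) (∉∧∈⇒≢ w∉S v∈S)
  ... | refl , inj₁ refl = v , inj₁ (u∈S , v∈S , u<v , eq)
  ... | refl , inj₂ refl = u , inj₂ (u∈S , v∈S , u<v , eq)

  edge-meets : ∀ {x y} → Adj G x y → x ∈ₛ S ⊎ y ∈ₛ S
  edge-meets {y = y} x~y with y ∈ₛ? S
  ... | yes y∈S = inj₂ y∈S
  ... | no  y∉S = inj₁ (Routed⇒∈ₛ (proj₂ (through-outside y∉S x~y)))

  module _ {P Q : List (Fin (V G))} (P-unique : Unique P) (Q-unique : Unique Q)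
           (P⊆S : All (_∈ₛ S) P) (P~Q : ∀ {x w} → x ∈ P → w ∈ Q → Adj G x w)
           (Q-neighbours : ∀ {w o} → w ∈ Q → Adj G w o → o ∈ P) where

    private
      In Out : List (Fin (V G))
      In  = filter (_∈ₛ? S) Q
      Out = filter (∁? (_∈ₛ? S)) Q

      P-disjoint-Out : ∀ {x} → x ∈ P → x ∉ Out
      P-disjoint-Out x∈P x∈Out = irrefl G (P~Q x∈P (proj₁ (∈-filter⁻ _ x∈Out)))

      partner-exists : ∀ {x w} → x ∈ P → w ∈ Out → ∃ λ o → o ∈ P × Routed x w o
      partner-exists x∈P w∈Out with w∈Q , w∉S ← ∈-filter⁻ _ w∈Out
        with o , x→o ← through-outside w∉S (P~Q x∈P w∈Q) =
        o , Q-neighbours w∈Q (Routed⇒Adj x→o) , x→o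

      open Routing Routed Routed-sym Routed-functional Routed-irrefl
                   P-unique (Unique.filter⁺ _ Q-unique) P-disjoint-Out partner-exists

      length-P+length-In≤∣S∣ : length P + length In ≤ ∣ S ∣
      length-P+length-In≤∣S∣ = subst (_≤ ∣ S ∣) (length-++ P)
        (unique⊆⇒length≤∣ S ∣
          (Unique.++⁺ P-unique (Unique.filter⁺ _ Q-unique)
            λ (x∈P , x∈In) → irrefl G (P~Q x∈P (proj₁ (∈-filter⁻ _ x∈In))))
          (++⁺ P⊆S (all-filter _ Q)))

      from-Out-bound : ∀ k → k + length Out ≤ length P → length Q + k ≤ ∣ S ∣
      from-Out-bound k Out-bound =
        count-bound (length-filter+length-filter-∁ _ Q) Out-bound length-P+length-In≤∣S∣

    -- When |P| is odd, |Out| = |P| - 1 would make |P| even.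
    full-side-bound : 2 ≤ length P → SideBound S (length P) (length Q)
    full-side-bound 2≤P =
      from-Out-bound 1 Out<P , λ P-odd → from-Out-bound 2 (≤∧≢⇒< Out<P (tight-even P-odd))
      where
      Out<P : length Out < length P
      Out<P = length-Out<length-P (proj₂ (∈-of-length 2≤P))

      tight-even : Odd (length P) → suc (length Out) ≢ length P
      tight-even P-odd tight = Even⇒¬Odd (length-P-even w∈Out (≤-reflexive (sym tight))) P-odd
        where w∈Out = proj₂ (∈-of-length (s≤s⁻¹ (subst (2 ≤_) (sym tight) 2≤P)))

-- The complete bipartite graph

module _ (n m : ℕ) where

  A-part B-part : List (Fin (n + m))
  A-part = tabulate (_↑ˡ m)
  B-part = tabulate (n ↑ʳ_)

  length-A-part : length A-part ≡ n
  length-A-part = length-tabulate (_↑ˡ m)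

  length-B-part : length B-part ≡ m
  length-B-part = length-tabulate (n ↑ʳ_)

  A-part-unique : Unique A-part
  A-part-unique = Unique.tabulate⁺ (↑ˡ-injective m _ _)

  B-part-unique : Unique B-part
  B-part-unique = Unique.tabulate⁺ (↑ʳ-injective n _ _)

  ∈A-part⇒< : ∀ {i} → i ∈ A-part → toℕ i < n
  ∈A-part⇒< i∈ with j , refl ← ∈-tabulate⁻ i∈ = subst (_< n) (sym (toℕ-↑ˡ j m)) (toℕ<n j)

  ∈B-part⇒≥ : ∀ {i} → i ∈ B-part → n ≤ toℕ i
  ∈B-part⇒≥ i∈ with j , refl ← ∈-tabulate⁻ i∈ = subst (n ≤_) (sym (toℕ-↑ʳ n j)) (m≤m+n n (toℕ j))

  ∈-parts : ∀ i → i ∈ A-part ⊎ i ∈ B-part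
  ∈-parts i with splitAt n i in split
  ... | inj₁ j = inj₁ (subst (_∈ A-part) (splitAt⁻¹-↑ˡ split) (∈-tabulate⁺ j))
  ... | inj₂ j = inj₂ (subst (_∈ B-part) (splitAt⁻¹-↑ʳ split) (∈-tabulate⁺ j))

  <⇒∈A-part : ∀ {i} → toℕ i < n → i ∈ A-part
  <⇒∈A-part {i} i<n with ∈-parts i
  ... | inj₁ i∈A = i∈A
  ... | inj₂ i∈B = contradiction (∈B-part⇒≥ i∈B) (<⇒≱ i<n)

  ≥⇒∈B-part : ∀ {i} → n ≤ toℕ i → i ∈ B-part
  ≥⇒∈B-part {i} n≤i with ∈-parts i
  ... | inj₁ i∈A = contradiction n≤i (<⇒≱ (∈A-part⇒< i∈A))
  ... | inj₂ i∈B = i∈B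

  A~B : ∀ {i j} → i ∈ A-part → j ∈ B-part → KAdj n m i j
  A~B i∈A j∈B = inj₁ (∈A-part⇒< i∈A , ∈B-part⇒≥ j∈B)

  B~A : ∀ {i j} → i ∈ B-part → j ∈ A-part → KAdj n m i j
  B~A i∈B j∈A = inj₂ (∈B-part⇒≥ i∈B , ∈A-part⇒< j∈A)

  A-neighbours : ∀ {i j} → i ∈ A-part → KAdj n m i j → j ∈ B-part
  A-neighbours _   (inj₁ (_ , n≤j))  = ≥⇒∈B-part n≤j
  A-neighbours i∈A (inj₂ (n≤i , _))  = contradiction n≤i (<⇒≱ (∈A-part⇒< i∈A))

  B-neighbours : ∀ {i j} → i ∈ B-part → KAdj n m i j → j ∈ A-part
  B-neighbours i∈B (inj₁ (i<n , _)) = contradiction (∈B-part⇒≥ i∈B) (<⇒≱ i<n)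
  B-neighbours _   (inj₂ (_ , j<n)) = <⇒∈A-part j<n

K-diameter≤2 : ∀ n m → Diameter≤2 (K (suc n) (suc m))
K-diameter≤2 n m u v with ∈-parts (suc n) (suc m) u | ∈-parts (suc n) (suc m) v
... | inj₁ u∈A | inj₁ v∈A = _ , step (A~B _ _ u∈A b∈B) (step (B~A _ _ b∈B v∈A) (single v)) , ≤-refl
  where
  b∈B : suc n ↑ʳ zero ∈ B-part (suc n) (suc m)
  b∈B = ∈-tabulate⁺ {f = suc n ↑ʳ_} zero
... | inj₁ u∈A | inj₂ v∈B = _ , step (A~B _ _ u∈A v∈B) (single v) , s≤s (s≤s z≤n)
... | inj₂ u∈B | inj₁ v∈A = _ , step (B~A _ _ u∈B v∈A) (single v) , s≤s (s≤s z≤n)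
... | inj₂ u∈B | inj₂ v∈B = _ , step (B~A _ _ u∈B a∈A) (step (A~B _ _ a∈A v∈B) (single v)) , ≤-refl
  where
  a∈A : zero ↑ˡ suc m ∈ A-part (suc n) (suc m)
  a∈A = ∈-tabulate⁺ {f = _↑ˡ suc m} zero

-- One part lies inside S, since otherwise some edge would miss S.
K-full-side-bound : ∀ {n m} (S : Subset (n + m)) → StrongEdgeGeodetic (K n m) S →
                    2 ≤ n → 2 ≤ m → SideBound S n m ⊎ SideBound S m n
K-full-side-bound {n@(suc n′)} {m@(suc m′)} S sg 2≤n 2≤m with all? (_∈ₛ? S) (A-part n m)
... | yes A⊆S = inj₁ (subst₂ (SideBound S) (length-A-part n m) (length-B-part n m)
        (full-side-bound (A-part-unique n m) (B-part-unique n m) A⊆S (A~B n m) (B-neighbours n m)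
          (subst (2 ≤_) (sym (length-A-part n m)) 2≤n)))
  where open DiameterTwo (K-diameter≤2 n′ m′) sg
... | no ¬A⊆S with a , a∈A , a∉S ← find (¬All⇒Any¬ (_∈ₛ? S) _ ¬A⊆S) =
      inj₂ (subst₂ (SideBound S) (length-B-part n m) (length-A-part n m)
        (full-side-bound (B-part-unique n m) (A-part-unique n m) B⊆S (B~A n m) (A-neighbours n m)
          (subst (2 ≤_) (sym (length-B-part n m)) 2≤m)))
  where
  open DiameterTwo (K-diameter≤2 n′ m′) sg
  B⊆S : All (_∈ₛ S) (B-part n m)
  B⊆S = All.tabulate λ b∈B →
    Sum.[ (λ a∈S → contradiction a∈S a∉S) , id ]′ (edge-meets (A~B n m a∈A b∈B))

corollary2p6 : (n : ℕ) → 3 ≤ n → Odd n →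
    ((S : Subset (n + n)) → StrongEdgeGeodetic (K n n) S → n + 2 ≤ ∣ S ∣)
    × ((S : Subset (n + (n ∸ 1))) → StrongEdgeGeodetic (K n (n ∸ 1)) S → n + 1 ≤ ∣ S ∣)
corollary2p6 n 3≤n n-odd = balanced , unbalanced
  where
  2≤n : 2 ≤ n
  2≤n = ≤-trans (n≤1+n 2) 3≤n

  balanced : (S : Subset (n + n)) → StrongEdgeGeodetic (K n n) S → n + 2 ≤ ∣ S ∣
  balanced S sg with K-full-side-bound S sg 2≤n 2≤n
  ... | inj₁ (_ , bound) = bound n-odd
  ... | inj₂ (_ , bound) = bound n-odd

  unbalanced : (S : Subset (n + (n ∸ 1))) → StrongEdgeGeodetic (K n (n ∸ 1)) S → n + 1 ≤ ∣ S ∣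
  unbalanced S sg with K-full-side-bound S sg 2≤n (∸-monoˡ-≤ 1 3≤n)
  ... | inj₁ (_ , bound) = subst (_≤ ∣ S ∣) n∸1+2≡n+1 (bound n-odd)
    where
    n∸1+2≡n+1 : n ∸ 1 + 2 ≡ n + 1
    n∸1+2≡n+1 = trans (sym (+-assoc (n ∸ 1) 1 1)) (cong (_+ 1) (m∸n+n≡m (≤-trans (s≤s z≤n) 3≤n)))
  ... | inj₂ (bound , _) = bound
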